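{- Let $k\ge2$, $n\ge2$, $1\le q\le k$, and let $f(x)\in P_1^{k,q}$. Let $a\in E_k$ with $\gcd(a,k)=1$, and for $i=1,\dots,n$ let $b_i\in E_k$ and $g_i(x_i)=[a f(x_i)+b_i]\bmod k$. Let $1<t\le n$ with $\gcd(t,k)=1$, and let $$h(x_1,\dots,x_n)=[g_1(x_1)+g_2(x_2)+\dots+g_n(x_n)]\bmod k.$$ Then identifying any $t$ distinct variables of $h$ (replacing all of them by a single new variable, or by any one of them) yields an $H(q)$-function belonging to $P_{n-t+1}^k$.
   Context: $E_k=\{0,1,\dots,k-1\}$; $P_n^k$ is the set of all functions $E_k^n\to E_k$; $P_m^{k,q}$ is the set of functions in $P_m^k$ taking exactly $q$ distinct values. For a variable $x_i$ of a function $f$, $Spr(x_i,f)$ is the set of numbers of distinct values of all one-variable functions obtained from $f$ by fixing all variables other than $x_i$ to constants in $E_k$ (for a one-variable function $g$, $Spr(x,g)=\{Rng(g)\}$, the number of values of $g$). A function is an $H(q)$-function if $Spr(x_i,f)=\{q\}$ for every variable $x_i$ of $f$. "$\bmod k$" denotes the residue in $E_k$. -}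

module Defs where

open import Data.Nat using (ℕ; zero; suc; _+_; _*_; NonZero)
open import Data.Nat.DivMod using (_mod_)
open import Data.Fin using (Fin; toℕ; _≟_)
open import Data.Fin.Properties using (any?)
open import Data.List using (List; length; filter; allFin)
open import Relation.Binary.PropositionalEquality using (_≡_)
import Data.Product
import Relation.Nullary

-- E_k is modelled as Fin k.  An m-ary function in P_m^k:
Fun : ℕ → ℕ → Set
Fun k m = (Fin m → Fin k) → Fin k

Rng : ∀ {k} → (Fin k → Fin k) → ℕ
Rng {k} g = length (filter (λ y → any? (λ x → g x ≟ y)) (allFin k))

InP1 : (k q : ℕ) → (Fin k → Fin k) → Set
InP1 k q f = Rng f ≡ q

_[_≔_] : ∀ {k m} → (Fin m → Fin k) → Fin m → Fin k → (Fin m → Fin k)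
(c [ i ≔ x ]) j with i Data.Fin.≟ j
... | Relation.Nullary.yes _ = x
... | Relation.Nullary.no _ = c j

_∈Spr[_,_] : ∀ {k m} → ℕ → Fin m → Fun k m → Set
_∈Spr[_,_] {k} {m} r i F =
  Data.Product.Σ (Fin m → Fin k) (λ c → Rng (λ x → F (c [ i ≔ x ])) ≡ r)

-- H(q)-function: Spr(x_i, F) = {q} for every variable x_i
IsH : ∀ {k m} → ℕ → Fun k m → Set
IsH {k} {m} q F = (i : Fin m) → (r : ℕ) →
  ((r ∈Spr[ i , F ]) → r ≡ q) Data.Product.× (r ≡ q → r ∈Spr[ i , F ])

sumFin : ∀ {n} → (Fin n → ℕ) → ℕ
sumFin {zero} v = 0
sumFin {suc n} v = v Data.Fin.zero + sumFin (λ i → v (Data.Fin.suc i))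

gfun : (k : ℕ) → .{{_ : NonZero k}} → (f : Fin k → Fin k) → (a b : Fin k) → Fin k → Fin k
gfun k f a b x = (toℕ a * toℕ (f x) + toℕ b) mod k

hfun : (k n : ℕ) → .{{_ : NonZero k}} → (f : Fin k → Fin k) → (a : Fin k) → (b : Fin n → Fin k) → Fun k n
hfun k n f a b x = sumFin (λ i → toℕ (gfun k f a (b i) (x i))) mod k

-- Identifying variables of h only changes how many times each new variable
-- occurs among the old ones: it occurs t times if it replaces the identified
-- block and once otherwise.  Fixing all new variables but one, y say, therefore
-- leaves the affine function x ↦ [N·a·f(x) + K] mod k, where N ∈ {t, 1} is the
-- number of occurrences of y.  As N·a is coprime to k, v ↦ [N·a·v + K] mod k is
-- a permutation of E_k, so this one-variable function takes exactly as many
-- values as f, namely q.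
module Submission where

open import Defs
open import Data.Empty using (⊥)
open import Data.Fin using (Fin; zero; suc; toℕ; _≟_)
open import Data.Fin.Properties using (any?; suc-injective; toℕ-fromℕ<; toℕ-injective; toℕ<n)
open import Data.List using (length; filter; tabulate)
open import Data.Nat using (ℕ; zero; suc; _+_; _*_; _∸_; _%_; _/_; _≤_; _<_; NonZero)
open import Data.Nat.Coprimality using (Coprime; coprime-divisor; gcd≡1⇒coprime; 1-coprimeTo)
import Data.Nat.Coprimality as Coprime
open import Data.Nat.DivMod using (_mod_; %-distribˡ-+; m%n%n≡m%n; m≡m%n+[m/n]*n; m<n⇒m%n≡m)
open import Data.Nat.Divisibility using (_∣_; divides; ∣-trans; ∣-reflexive; >⇒∤)
open import Data.Nat.GCD using (gcd)
open import Data.Nat.Properties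
  using (+-*-semiring; +-comm; +-identityʳ; *-assoc; *-identityˡ; ≤-total; ≤-antisym; ≤-<-trans;
         m∸n≤m; m∸n≡0⇒m≤n; *-distribʳ-∸; *-distribˡ-∸; [m+n]∸[m+o]≡n∸o)
open import Algebra.Properties.Semiring.Sum +-*-semiring
  using (sum; sum-syntax; sum-cong-≗; ∑-comm; ∑-distrib-+; *-distribʳ-sum)
open import Data.Product using (∃; _×_; _,_; proj₁; proj₂)
open import Data.Sum using (_⊎_; inj₁; inj₂; [_,_]′)
open import Data.Unit using (⊤; tt)
open import Function using (_∘_; _⇔_; mk⇔; Equivalence)
open import Function.Definitions using (Injective; Surjective)
open import Relation.Nullary using (Dec; yes; no; _×-dec_; contradiction)
open import Relation.Unary using (Decidable)
open import Relation.Binary.PropositionalEquality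
  using (_≡_; refl; sym; trans; cong; cong₂; subst; module ≡-Reasoning)

open Equivalence using (to; from)

private
  variable
    k m n t : ℕ

𝟙 : ∀ {A : Set} → Dec A → ℕ
𝟙 (yes _) = 1
𝟙 (no _) = 0

𝟙-yes : ∀ {A : Set} (a? : Dec A) → A → 𝟙 a? ≡ 1
𝟙-yes (yes _) _ = refl
𝟙-yes (no ¬a) a = contradiction a ¬a

count : ∀ {P : Fin n → Set} → Decidable P → ℕ
count {n} P? = ∑[ i < n ] 𝟙 (P? i)

count-yes : count {n} (λ _ → yes tt) ≡ n
count-yes {zero} = refl
count-yes {suc n} = cong suc (count-yes {n})

count-subsingleton : ∀ {P : Fin n → Set} (P? : Decidable P) → (∀ {i j} → P i → P j → i ≡ j) →
  ∀ {E : Set} (E? : Dec E) → E ⇔ ∃ P → count P? ≡ 𝟙 E?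
count-subsingleton {zero} P? _ (yes e) E⇔∃P with () ← proj₁ (to E⇔∃P e)
count-subsingleton {zero} P? _ (no _) _ = refl
count-subsingleton {suc n} {P} P? unique {E} E? E⇔∃P with P? zero
... | yes p = trans (cong suc noOther) (sym (𝟙-yes E? (from E⇔∃P (zero , p))))
  where
  unique-suc : ∀ {i j} → P (suc i) → P (suc j) → i ≡ j
  unique-suc p q = suc-injective (unique p q)
  noOther : count (P? ∘ suc) ≡ 0
  noOther = count-subsingleton (P? ∘ suc) unique-suc {⊥} (no (λ ()))
    (mk⇔ (λ ()) (λ (i , q) → contradiction (unique p q) λ ()))
... | no ¬p = count-subsingleton (P? ∘ suc) (λ p q → suc-injective (unique p q)) E?
                (mk⇔ shift (λ (i , q) → from E⇔∃P (suc i , q)))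
  where
  shift : E → ∃ (P ∘ suc)
  shift e with to E⇔∃P e
  ... | zero , p = contradiction p ¬p
  ... | suc i , q = i , q

count-image : ∀ {Q : Fin m → Set} {R : Fin n → Set} (P : Fin m → Fin n) → Injective _≡_ _≡_ P →
  (Q? : Decidable Q) (R? : Decidable R) → (∀ y → R y ⇔ ∃ λ z → Q z × P z ≡ y) →
  count R? ≡ count Q?
-- Double counting of the pairs (z , y) with Q z and P z ≡ y.
count-image {m} {n} {Q} P P-inj Q? R? R⇔ = begin
  ∑[ y < n ] 𝟙 (R? y)                ≡⟨ sum-cong-≗ (sym ∘ countPreimage) ⟩
  ∑[ y < n ] ∑[ z < m ] 𝟙 (hit? y z) ≡⟨ ∑-comm (λ y z → 𝟙 (hit? y z)) ⟩
  ∑[ z < m ] ∑[ y < n ] 𝟙 (hit? y z) ≡⟨ sum-cong-≗ countImage ⟩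
  ∑[ z < m ] 𝟙 (Q? z)                ∎
  where
  open ≡-Reasoning
  hit? : ∀ y → Decidable (λ z → Q z × P z ≡ y)
  hit? y z = Q? z ×-dec (P z ≟ y)
  countPreimage : ∀ y → count (hit? y) ≡ 𝟙 (R? y)
  countPreimage y = count-subsingleton (hit? y) (λ (_ , e) (_ , e′) → P-inj (trans e (sym e′))) (R? y) (R⇔ y)
  countImage : ∀ z → count (λ y → hit? y z) ≡ 𝟙 (Q? z)
  countImage z = count-subsingleton (λ y → hit? y z) (λ (_ , e) (_ , e′) → trans (sym e) e′) (Q? z)
    (mk⇔ (λ q → P z , q , refl) (proj₁ ∘ proj₂))

length-filter-tabulate : ∀ {A : Set} {R : A → Set} (R? : Decidable R) (h : Fin n → A) →
  length (filter R? (tabulate h)) ≡ count (R? ∘ h)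
length-filter-tabulate {zero} R? h = refl
length-filter-tabulate {suc n} R? h with R? (h zero)
... | yes _ = cong suc (length-filter-tabulate R? (h ∘ suc))
... | no _ = length-filter-tabulate R? (h ∘ suc)

Rng≡count : (g : Fin k → Fin k) → Rng g ≡ count (λ y → any? (λ x → g x ≟ y))
Rng≡count g = length-filter-tabulate (λ y → any? (λ x → g x ≟ y)) (λ y → y)

Rng-∘-injective : (P : Fin k → Fin k) → Injective _≡_ _≡_ P → (g h : Fin k → Fin k) →
  (∀ x → h x ≡ P (g x)) → Rng h ≡ Rng g
Rng-∘-injective P P-inj g h h≗P∘g = begin
  Rng h                                        ≡⟨ Rng≡count h ⟩
  count (λ y → any? (λ x → h x ≟ y))           ≡⟨ count-image P P-inj _ _ image ⟩
  count (λ z → any? (λ x → g x ≟ z))           ≡⟨ sym (Rng≡count g) ⟩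
  Rng g                                        ∎
  where
  open ≡-Reasoning
  image : ∀ y → (∃ λ x → h x ≡ y) ⇔ ∃ λ z → (∃ λ x → g x ≡ z) × P z ≡ y
  image y = mk⇔ (λ (x , hx≡y) → g x , (x , refl) , trans (sym (h≗P∘g x)) hx≡y)
                (λ { (_ , (x , refl) , Pz≡y) → x , trans (h≗P∘g x) Pz≡y })

%-distrib-sum : ∀ .{{_ : NonZero k}} (u : Fin n → ℕ) →
  (∑[ i < n ] (u i % k)) % k ≡ (∑[ i < n ] u i) % k
%-distrib-sum {n = zero} u = refl
%-distrib-sum {k} {n = suc n} u = begin
  (u zero % k + ∑[ i < n ] (u (suc i) % k)) % k           ≡⟨ %-distribˡ-+ (u zero % k) _ k ⟩
  (u zero % k % k + ∑[ i < n ] (u (suc i) % k) % k) % k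
    ≡⟨ cong₂ (λ x y → (x + y) % k) (m%n%n≡m%n (u zero) k) (%-distrib-sum (u ∘ suc)) ⟩
  (u zero % k + ∑[ i < n ] u (suc i) % k) % k             ≡⟨ sym (%-distribˡ-+ (u zero) _ k) ⟩
  (u zero + ∑[ i < n ] u (suc i)) % k                     ∎
  where open ≡-Reasoning

m%d≡n%d⇒d∣n∸m : ∀ x y d .{{_ : NonZero d}} → x % d ≡ y % d → d ∣ y ∸ x
m%d≡n%d⇒d∣n∸m x y d x%d≡y%d = divides (y / d ∸ x / d) (begin
  y ∸ x                                   ≡⟨ cong₂ _∸_ (m≡m%n+[m/n]*n y d) (m≡m%n+[m/n]*n x d) ⟩
  (y % d + y / d * d) ∸ (x % d + x / d * d) ≡⟨ cong (λ r → (y % d + y / d * d) ∸ (r + x / d * d)) x%d≡y%d ⟩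
  (y % d + y / d * d) ∸ (y % d + x / d * d) ≡⟨ [m+n]∸[m+o]≡n∸o (y % d) _ _ ⟩
  y / d * d ∸ x / d * d                   ≡⟨ sym (*-distribʳ-∸ d (y / d) (x / d)) ⟩
  (y / d ∸ x / d) * d                     ∎)
  where open ≡-Reasoning

∣∧<⇒≡0 : ∀ {d x} → d ∣ x → x < d → x ≡ 0
∣∧<⇒≡0 {x = zero} _ _ = refl
∣∧<⇒≡0 {x = suc x} d∣x x<d = contradiction d∣x (>⇒∤ x<d)

coprime-* : ∀ {a b} → Coprime k a → Coprime k b → Coprime k (a * b)
coprime-* {k} k⊥a k⊥b (i∣k , i∣ab) =
  k⊥b (i∣k , coprime-divisor (λ (d∣i , d∣a) → k⊥a (∣-trans d∣i i∣k , d∣a)) i∣ab)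

affine : (k : ℕ) .{{_ : NonZero k}} → (c K : ℕ) → Fin k → Fin k
affine k c K v = (K + c * toℕ v) mod k

affine-cancel-≤ : ∀ .{{_ : NonZero k}} {c} K → Coprime k c → (u v : Fin k) → toℕ u ≤ toℕ v →
  affine k c K u ≡ affine k c K v → u ≡ v
affine-cancel-≤ {k} {c} K k⊥c u v u≤v eq = toℕ-injective (≤-antisym u≤v (m∸n≡0⇒m≤n v∸u≡0))
  where
  residues : (K + c * toℕ u) % k ≡ (K + c * toℕ v) % k
  residues = trans (sym (toℕ-fromℕ< _)) (trans (cong toℕ eq) (toℕ-fromℕ< _))
  difference : (K + c * toℕ v) ∸ (K + c * toℕ u) ≡ c * (toℕ v ∸ toℕ u)
  difference = trans ([m+n]∸[m+o]≡n∸o K _ _) (sym (*-distribˡ-∸ c (toℕ v) (toℕ u)))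
  v∸u≡0 : toℕ v ∸ toℕ u ≡ 0
  v∸u≡0 = ∣∧<⇒≡0
    (coprime-divisor k⊥c (∣-trans (m%d≡n%d⇒d∣n∸m _ _ k residues) (∣-reflexive difference)))
    (≤-<-trans (m∸n≤m (toℕ v) (toℕ u)) (toℕ<n v))

affine-injective : ∀ .{{_ : NonZero k}} {c} K → Coprime k c → Injective _≡_ _≡_ (affine k c K)
affine-injective K k⊥c {u} {v} eq with ≤-total (toℕ u) (toℕ v)
... | inj₁ u≤v = affine-cancel-≤ K k⊥c u v u≤v eq
... | inj₂ v≤u = sym (affine-cancel-≤ K k⊥c v u v≤u (sym eq))

sumFin≡sum : (v : Fin n → ℕ) → sumFin v ≡ sum v
sumFin≡sum {zero} v = refl
sumFin≡sum {suc n} v = cong (v zero +_) (sumFin≡sum (v ∘ suc))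

preimageSize : (σ : Fin n → Fin m) → Fin m → ℕ
preimageSize σ j = count (λ i → j ≟ σ i)

hfun-restriction-affine : ∀ .{{_ : NonZero k}} (f : Fin k → Fin k) (a : Fin k) (b : Fin n → Fin k)
  (σ : Fin n → Fin m) (c : Fin m → Fin k) (j : Fin m) → ∃ λ K → ∀ x →
  hfun k n f a b (λ i → (c [ j ≔ x ]) (σ i)) ≡ affine k (preimageSize σ j * toℕ a) K (f x)
hfun-restriction-affine {k} {n} f a b σ c j = K , λ x → toℕ-injective (begin
  toℕ (hfun k n f a b (λ i → (c [ j ≔ x ]) (σ i)))  ≡⟨ toℕ-fromℕ< _ ⟩
  sumFin (term x) % k                                 ≡⟨ cong (_% k) (sumFin≡sum (term x)) ⟩
  (∑[ i < n ] term x i) % k                           ≡⟨ cong (_% k) (sum-cong-≗ (term≡ x)) ⟩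
  (∑[ i < n ] ((offset i + weight i * A x) % k)) % k  ≡⟨ %-distrib-sum (λ i → offset i + weight i * A x) ⟩
  (∑[ i < n ] (offset i + weight i * A x)) % k        ≡⟨ cong (_% k) (∑-distrib-+ offset (λ i → weight i * A x)) ⟩
  (K + ∑[ i < n ] (weight i * A x)) % k               ≡⟨ cong (λ s → (K + s) % k) (sym (*-distribʳ-sum (A x) weight)) ⟩
  (K + preimageSize σ j * (toℕ a * toℕ (f x))) % k    ≡⟨ cong (λ s → (K + s) % k) (sym (*-assoc (preimageSize σ j) _ _)) ⟩
  (K + preimageSize σ j * toℕ a * toℕ (f x)) % k      ≡⟨ sym (toℕ-fromℕ< _) ⟩
  toℕ (affine k (preimageSize σ j * toℕ a) K (f x))  ∎)
  where
  open ≡-Reasoning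
  g : Fin n → Fin k → Fin k
  g i = gfun k f a (b i)
  term : Fin k → Fin n → ℕ
  term x i = toℕ (g i ((c [ j ≔ x ]) (σ i)))
  weight : Fin n → ℕ
  weight i = 𝟙 (j ≟ σ i)
  A : Fin k → ℕ
  A x = toℕ a * toℕ (f x)
  offset′ : ∀ i → Dec (j ≡ σ i) → ℕ
  offset′ i (yes _) = toℕ (b i)
  offset′ i (no _) = toℕ (g i (c (σ i)))
  offset : Fin n → ℕ
  offset i = offset′ i (j ≟ σ i)
  K : ℕ
  K = ∑[ i < n ] offset i
  term≡ : ∀ x i → term x i ≡ (offset′ i (j ≟ σ i) + 𝟙 (j ≟ σ i) * A x) % k
  term≡ x i with j ≟ σ i
  ... | yes _ = trans (toℕ-fromℕ< _)
                      (cong (_% k) (trans (+-comm (A x) _) (cong (toℕ (b i) +_) (sym (*-identityˡ (A x))))))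
  ... | no _ = trans (sym (m<n⇒m%n≡m (toℕ<n _))) (cong (_% k) (sym (+-identityʳ _)))

Rng-hfun-restriction : ∀ .{{_ : NonZero k}} (f : Fin k → Fin k) (a : Fin k) (b : Fin n → Fin k)
  (σ : Fin n → Fin m) (c : Fin m → Fin k) (j : Fin m) → Coprime k (preimageSize σ j * toℕ a) →
  Rng (λ x → hfun k n f a b (λ i → (c [ j ≔ x ]) (σ i))) ≡ Rng f
Rng-hfun-restriction {k} f a b σ c j k⊥slope with hfun-restriction-affine f a b σ c j
... | K , restriction≡affine =
  Rng-∘-injective (affine k (preimageSize σ j * toℕ a) K) (affine-injective K k⊥slope) f _ restriction≡affine

MergesImage : (e : Fin t → Fin n) (σ : Fin n → Fin m) → Set
MergesImage e σ = ∀ x y → (σ x ≡ σ y → (x ≡ y ⊎ ((∃ λ i → e i ≡ x) × (∃ λ j → e j ≡ y))))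
                        × ((x ≡ y ⊎ ((∃ λ i → e i ≡ x) × (∃ λ j → e j ≡ y))) → σ x ≡ σ y)

preimageSize-merge : (e : Fin t → Fin n) → Injective _≡_ _≡_ e →
  (σ : Fin n → Fin m) → Surjective _≡_ _≡_ σ → MergesImage e σ →
  ∀ j → preimageSize σ j ≡ t ⊎ preimageSize σ j ≡ 1
preimageSize-merge {n = n} e e-inj σ σ-surj merges j with any? (λ i → σ (e i) ≟ j)
... | yes (i₀ , σei₀≡j) =
  inj₁ (trans (count-image e e-inj (λ _ → yes tt) (λ i → j ≟ σ i) (λ i → mk⇔ toImage fromImage))
              count-yes)
  where
  toImage : ∀ {i} → j ≡ σ i → ∃ λ z → ⊤ × e z ≡ i
  toImage {i} j≡σi with proj₁ (merges (e i₀) i) (trans σei₀≡j j≡σi)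
  ... | inj₁ ei₀≡i = i₀ , tt , ei₀≡i
  ... | inj₂ (_ , z , ez≡i) = z , tt , ez≡i
  fromImage : ∀ {i} → ∃ (λ z → ⊤ × e z ≡ i) → j ≡ σ i
  fromImage (z , _ , refl) =
    trans (sym σei₀≡j) (proj₂ (merges (e i₀) (e z)) (inj₂ ((i₀ , refl) , (z , refl))))
... | no ∄i =
  inj₂ (count-subsingleton (λ i → j ≟ σ i) unique (yes tt) (mk⇔ (λ _ → i₀ , sym σi₀≡j) (λ _ → tt)))
  where
  i₀ : Fin n
  i₀ = proj₁ (σ-surj j)
  σi₀≡j : σ i₀ ≡ j
  σi₀≡j = proj₂ (σ-surj j) refl
  unique : ∀ {i i′} → j ≡ σ i → j ≡ σ i′ → i ≡ i′
  unique {i} {i′} j≡σi j≡σi′ with proj₁ (merges i i′) (trans (sym j≡σi) j≡σi′)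
  ... | inj₁ i≡i′ = i≡i′
  ... | inj₂ ((z , ez≡i) , _) = contradiction (z , trans (cong σ ez≡i) (sym j≡σi)) ∄i

IsH-intro : ∀ {q} {F : Fun k m} → Fin k → (∀ c j → Rng (λ x → F (c [ j ≔ x ])) ≡ q) → IsH q F
IsH-intro x₀ Rng≡q j r = (λ (c , Rng≡r) → trans (sym Rng≡r) (Rng≡q c j))
                       , (λ r≡q → (λ _ → x₀) , trans (Rng≡q (λ _ → x₀) j) (sym r≡q))

corollary2p9 : (k n q : ℕ) → .{{_ : NonZero k}} → 2 ≤ k → 2 ≤ n → 1 ≤ q → q ≤ k →
    (f : Fin k → Fin k) → InP1 k q f →
    (a : Fin k) → gcd (toℕ a) k ≡ 1 → (b : Fin n → Fin k) →
    (t : ℕ) → 1 < t → t ≤ n → gcd t k ≡ 1 →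
    (e : Fin t → Fin n) → Injective _≡_ _≡_ e →
    (σ : Fin n → Fin (suc (n ∸ t))) → Surjective _≡_ _≡_ σ →
    (∀ x y → (σ x ≡ σ y → (x ≡ y ⊎ ((∃ λ i → e i ≡ x) × (∃ λ j → e j ≡ y))))
           × ((x ≡ y ⊎ ((∃ λ i → e i ≡ x) × (∃ λ j → e j ≡ y))) → σ x ≡ σ y)) →
    IsH q (λ (y : Fin (suc (n ∸ t)) → Fin k) → hfun k n f a b (λ i → y (σ i)))
corollary2p9 k n q _ _ _ _ f Rngf≡q a gcd[a,k]≡1 b t _ _ gcd[t,k]≡1 e e-inj σ σ-surj merges =
  IsH-intro {F = λ y → hfun k n f a b (λ i → y (σ i))} (0 mod k) λ c j →
    trans (Rng-hfun-restriction f a b σ c j (coprime-* (k⊥preimageSize j) k⊥a)) Rngf≡q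
  where
  k⊥a : Coprime k (toℕ a)
  k⊥a = Coprime.sym (gcd≡1⇒coprime gcd[a,k]≡1)
  k⊥preimageSize : ∀ j → Coprime k (preimageSize σ j)
  k⊥preimageSize j =
    [ (λ size≡t → subst (Coprime k) (sym size≡t) (Coprime.sym (gcd≡1⇒coprime gcd[t,k]≡1)))
    , (λ size≡1 → subst (Coprime k) (sym size≡1) (Coprime.sym (1-coprimeTo k)))
    ]′ (preimageSize-merge e e-inj σ σ-surj merges j)
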